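{- Let $n\ge 1$. If $Y\subseteq S_n$ is a nonempty $1$-design in $(S_n,d_S)$, then $|Y|\ge n$.
   Context: $S_n$ is the symmetric group on $n$ letters. For $\nu\in S_n$ let $F(\nu)$ be its number of fixed points; the metric is $d_S(\sigma,\theta)=n-F(\sigma\theta^{ -1})$. For $j\in\{0,\dots,n\}$ let $v_j$ be the number of permutations with exactly $n-j$ fixed points. For nonempty $D\subseteq S_n$, its frequencies are $f_i=|\{(x,y)\in D^2: d_S(x,y)=i\}|/|D|^2$, $i=0,\dots,n$. $D$ is a $t$-design if $\sum_{j=0}^n f_j j^i=\sum_{j=0}^n \frac{v_j}{n!} j^i$ for every $i=1,\dots,t$. -}

module Defs where

open import Data.Nat using (ℕ; zero; suc; _+_; _*_; _∸_; _^_; _!; _≤_)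
import Data.Nat as ℕ
import Data.Bool as 𝔹
open import Data.Product using (proj₁; proj₂)
open import Data.Nat.ListAction using (sum)
open import Data.Bool.ListAction using (and)
open import Data.Fin using (Fin; _≟_)
open import Data.Fin.Permutation using (Permutation′; _⟨$⟩ʳ_; flip; _∘ₚ_)
open import Data.List using (List; []; _∷_; length; filter; map; concatMap; upTo; allFin; cartesianProduct)
open import Data.List.Relation.Unary.AllPairs using (AllPairs)
open import Data.Vec using (Vec; lookup) renaming ([] to []ᵥ; _∷_ to _∷ᵥ_)
open import Data.Bool using (Bool; true; false; _∧_; not)
open import Relation.Binary.PropositionalEquality using (_≡_)
open import Relation.Nullary using (¬_; does)

F : {n : ℕ} → Permutation′ n → ℕ
F {n} ν = length (filter (λ x → (ν ⟨$⟩ʳ x) ≟ x) (allFin n))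

-- σ θ⁻¹ : apply θ⁻¹ first, then σ   (π₁ ∘ₚ π₂ applies π₁ first).
_·_⁻¹ : {n : ℕ} → Permutation′ n → Permutation′ n → Permutation′ n
σ · θ ⁻¹ = flip θ ∘ₚ σ

dS : {n : ℕ} → Permutation′ n → Permutation′ n → ℕ
dS {n} σ θ = n ∸ F (σ · θ ⁻¹)

-- Enumeration of S_n (as injective maps Fin n → Fin n, given by their
-- value tables), used to define v_j.

allVecs : (n k : ℕ) → List (Vec (Fin n) k)
allVecs n zero = []ᵥ ∷ []
allVecs n (suc k) = concatMap (λ x → map (x ∷ᵥ_) (allVecs n k)) (allFin n)

isPermᵇ : {n : ℕ} → Vec (Fin n) n → Bool
isPermᵇ {n} v =
  and (map (λ i → and (map (λ j → does (i ≟ j) ∨' not (does (lookup v i ≟ lookup v j)))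
                           (allFin n)))
           (allFin n))
  where
  _∨'_ : Bool → Bool → Bool
  true ∨' _ = true
  false ∨' b = b

fixedᵥ : {n : ℕ} → Vec (Fin n) n → ℕ
fixedᵥ {n} v = length (filter (λ x → lookup v x ≟ x) (allFin n))

Sn : (n : ℕ) → List (Vec (Fin n) n)
Sn n = filter (λ v → 𝔹._≟_ (isPermᵇ v) true) (allVecs n n)

vcount : (n j : ℕ) → ℕ
vcount n j = length (filter (λ v → ℕ._≟_ (fixedᵥ v) (n ∸ j)) (Sn n))

-- Frequencies, with the common denominator |D|² cleared:
-- pairCount D i = |{(x,y) ∈ D² : d_S(x,y) = i}|  (so f_i = pairCount D i / |D|²).

pairCount : {n : ℕ} → List (Permutation′ n) → ℕ → ℕ
pairCount D i =
  length (filter (λ p → ℕ._≟_ (dS (proj₁ p) (proj₂ p)) i)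
                 (cartesianProduct D D))

Σ0to : ℕ → (ℕ → ℕ) → ℕ
Σ0to n g = sum (map g (upTo (suc n)))

-- D is a t-design:  for every i = 1..t,
--   Σ_j f_j j^i = Σ_j (v_j / n!) j^i,
-- i.e. (multiplying by |D|² · n!)
--   n! · Σ_j pairCount D j · j^i = |D|² · Σ_j v_j · j^i.
IsDesign : (n t : ℕ) → List (Permutation′ n) → Set
IsDesign n t D =
  (i : ℕ) → 1 ≤ i → i ≤ t →
    (n !) * Σ0to n (λ j → pairCount D j * j ^ i)
      ≡ (length D * length D) * Σ0to n (λ j → vcount n j * j ^ i)

-- D is a set (no repeated permutations, equality being extensional).
DistinctPerms : {n : ℕ} → List (Permutation′ n) → Set
DistinctPerms {n} = AllPairs (λ σ θ → ¬ ((x : Fin n) → σ ⟨$⟩ʳ x ≡ θ ⟨$⟩ʳ x))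

-- Averaging d_S over Y × Y.  The design condition for i = 1 says that the mean of
-- d_S(σ, θ) over Y × Y equals the mean distance in S_n from the identity, which is n − 1
-- because a random permutation has on average one fixed point.  But the |Y| diagonal
-- pairs are at distance 0 and all others at distance at most n, so
-- |Y|² (n − 1) ≤ |Y| (|Y| − 1) n, that is n ≤ |Y|.
--
-- The average number of fixed points is computed on the enumeration Sn of value tables:
-- extending injective k-tuples by one entry shows that every value is equally frequent at
-- every position, so each point is fixed by exactly |Sn| / n of them, and |Sn| = n!.

module Submission where

open import Data.Bool using (Bool; true; false; _∧_; not; T; if_then_else_)
import Data.Bool as 𝔹
open import Data.Bool.ListAction using (all)
open import Data.Bool.Properties using (T-∧; T-≡; ⇔→≡)
open import Data.Fin using (Fin; zero; suc; _≟_)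
open import Data.Fin.Permutation using (Permutation′; _⟨$⟩ʳ_; inverseʳ)
import Data.Fin.Properties as Fin
open import Data.List
  using (List; []; _∷_; _++_; map; filter; length; concatMap; cartesianProduct; allFin; upTo)
open import Data.List.Membership.Propositional using (_∈_)
open import Data.List.Membership.Propositional.Properties using (∈-allFin; ∈-upTo⁺; ∈-upTo⁻)
open import Data.List.Properties using (map-tabulate; length-tabulate; filter-all; length-filter)
open import Data.List.Relation.Unary.All as All using (All; []; _∷_)
open import Data.List.Relation.Unary.All.Properties using (all⁺; all⁻)
open import Data.List.Relation.Unary.AllPairs using (_∷_)
open import Data.List.Relation.Unary.Any using (here; there)
open import Data.List.Relation.Unary.Unique.Propositional using (Unique)
open import Data.List.Relation.Unary.Unique.Propositional.Properties using (allFin⁺; upTo⁺)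
open import Data.Nat using (ℕ; zero; suc; _+_; _*_; _∸_; _^_; _!; _≤_; _<_; z≤n; s≤s; NonZero; >-nonZero)
import Data.Nat as ℕ
open import Data.Nat.Combinatorics using (nPn≡n!)
open import Data.Nat.Combinatorics.Base using (_P′_)
open import Data.Nat.ListAction using (sum)
open import Data.Nat.Properties hiding (_≟_)
open import Algebra.Properties.CommutativeSemigroup +-commutativeSemigroup
  using () renaming (interchange to +-interchange)
open import Algebra.Properties.CommutativeSemigroup *-commutativeSemigroup
  using () renaming (x∙yz≈y∙xz to *-leftComm)
open import Data.Nat.Tactic.RingSolver using (solve-∀)
open import Data.Product using (_,_; proj₁; proj₂)
open import Data.Vec using (Vec; lookup) renaming ([] to []ᵥ; _∷_ to _∷ᵥ_)
open import Data.Vec.Membership.Propositional using () renaming (_∈_ to _∈ᵥ_; _∉_ to _∉ᵥ_)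
open import Data.Vec.Membership.Propositional.Properties using (∈-lookup)
open import Data.Vec.Relation.Unary.Any using (index)
open import Data.Vec.Relation.Unary.Any.Properties using (lookup-index)
open import Defs
open import Function using (_∘_; _⇔_; mk⇔; Equivalence; Injective)
import Function.Properties.Equivalence as ⇔
open import Level using (Level)
open import Relation.Binary.Definitions using (DecidableEquality)
open import Relation.Binary.PropositionalEquality
open import Relation.Nullary using (Dec; yes; no; does; ¬_; _⊎-dec_)
open import Relation.Nullary.Decidable using (dec-true; dec-false)
open import Relation.Nullary.Negation using (contradiction)

-- Indicators

𝟙 : Bool → ℕ
𝟙 true  = 1
𝟙 false = 0

𝟙-∧ : ∀ a b → 𝟙 (a ∧ b) ≡ 𝟙 a * 𝟙 b
𝟙-∧ true  b = sym (+-identityʳ (𝟙 b))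
𝟙-∧ false b = refl

𝟙-not : ∀ b → 𝟙 (not b) + 𝟙 b ≡ 1
𝟙-not true  = refl
𝟙-not false = refl

𝟙-guard : ∀ b {x y} → (T b → x ≡ y) → 𝟙 b * x ≡ 𝟙 b * y
𝟙-guard true  x≡y = cong (1 *_) (x≡y _)
𝟙-guard false x≡y = refl

module _ {p q} {P : Set p} {Q : Set q} where

  𝟙-does-⇔ : (P? : Dec P) (Q? : Dec Q) → P ⇔ Q → 𝟙 (does P?) ≡ 𝟙 (does Q?)
  𝟙-does-⇔ (yes p) Q? P⇔Q = cong 𝟙 (sym (dec-true Q? (Equivalence.to P⇔Q p)))
  𝟙-does-⇔ (no ¬p) Q? P⇔Q = cong 𝟙 (sym (dec-false Q? (¬p ∘ Equivalence.from P⇔Q)))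

  𝟙-⊎-dec : (P? : Dec P) (Q? : Dec Q) → (P → ¬ Q) →
    𝟙 (does (P? ⊎-dec Q?)) ≡ 𝟙 (does P?) + 𝟙 (does Q?)
  𝟙-⊎-dec (yes p) Q? disjoint = cong (λ b → 1 + 𝟙 b) (sym (dec-false Q? (disjoint p)))
  𝟙-⊎-dec (no _)  Q? disjoint = refl

T-not-does⇔¬ : ∀ {p} {P : Set p} (P? : Dec P) → T (not (does P?)) ⇔ (¬ P)
T-not-does⇔¬ (yes p) = mk⇔ (λ ()) (λ ¬p → ¬p p)
T-not-does⇔¬ (no ¬p) = mk⇔ (λ _ → ¬p) (λ _ → _)

-- Sums over lists

private
  variable
    ℓ ℓ′ : Level
    A : Set ℓ
    B : Set ℓ′

∑ : List A → (A → ℕ) → ℕ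
∑ xs f = sum (map f xs)

infix 6.5 ∑
syntax ∑ xs (λ x → e) = ∑[ x ∈ xs ] e

∑-cong : ∀ (xs : List A) {f g : A → ℕ} → (∀ {x} → x ∈ xs → f x ≡ g x) → ∑ xs f ≡ ∑ xs g
∑-cong []       f≗g = refl
∑-cong (x ∷ xs) f≗g = cong₂ _+_ (f≗g (here refl)) (∑-cong xs (f≗g ∘ there))

∑-mono-≤ : ∀ (xs : List A) {f g : A → ℕ} → (∀ {x} → x ∈ xs → f x ≤ g x) → ∑ xs f ≤ ∑ xs g
∑-mono-≤ []       f≤g = z≤n
∑-mono-≤ (x ∷ xs) f≤g = +-mono-≤ (f≤g (here refl)) (∑-mono-≤ xs (f≤g ∘ there))

∑-distrib-+ : ∀ (xs : List A) (f g : A → ℕ) → ∑[ x ∈ xs ] (f x + g x) ≡ ∑ xs f + ∑ xs g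
∑-distrib-+ []       f g = refl
∑-distrib-+ (x ∷ xs) f g =
  trans (cong (f x + g x +_) (∑-distrib-+ xs f g)) (+-interchange (f x) (g x) (∑ xs f) (∑ xs g))

*-distribˡ-∑ : ∀ c (xs : List A) (f : A → ℕ) → c * ∑ xs f ≡ ∑[ x ∈ xs ] c * f x
*-distribˡ-∑ c []       f = *-zeroʳ c
*-distribˡ-∑ c (x ∷ xs) f =
  trans (*-distribˡ-+ c (f x) _) (cong (c * f x +_) (*-distribˡ-∑ c xs f))

*-distribʳ-∑ : ∀ c (xs : List A) (f : A → ℕ) → ∑ xs f * c ≡ ∑[ x ∈ xs ] f x * c
*-distribʳ-∑ c xs f = trans (*-comm (∑ xs f) c)
  (trans (*-distribˡ-∑ c xs f) (∑-cong xs (λ {x} _ → *-comm c (f x))))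

∑-const : ∀ (xs : List A) c → ∑[ x ∈ xs ] c ≡ length xs * c
∑-const []       c = refl
∑-const (x ∷ xs) c = cong (c +_) (∑-const xs c)

∑-≤-with-zero : ∀ (xs : List A) {f : A → ℕ} {c x} →
  (∀ y → f y ≤ c) → x ∈ xs → f x ≡ 0 → ∑ xs f + c ≤ length xs * c
∑-≤-with-zero (y ∷ ys) {f} {c} f≤c (here refl) fy≡0 = begin
  f y + ∑ ys f + c    ≡⟨ cong (λ m → m + ∑ ys f + c) fy≡0 ⟩
  ∑ ys f + c          ≡⟨ +-comm (∑ ys f) c ⟩
  c + ∑ ys f          ≤⟨ +-monoʳ-≤ c (∑-mono-≤ ys (λ _ → f≤c _)) ⟩
  c + ∑[ _ ∈ ys ] c   ≡⟨ cong (c +_) (∑-const ys c) ⟩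
  c + length ys * c   ∎
  where open ≤-Reasoning
∑-≤-with-zero (y ∷ ys) {f} {c} f≤c (there x∈ys) fx≡0 = begin
  f y + ∑ ys f + c    ≡⟨ +-assoc (f y) (∑ ys f) c ⟩
  f y + (∑ ys f + c)  ≤⟨ +-mono-≤ (f≤c y) (∑-≤-with-zero ys f≤c x∈ys fx≡0) ⟩
  c + length ys * c   ∎
  where open ≤-Reasoning

∑-++ : ∀ (xs ys : List A) (f : A → ℕ) → ∑ (xs ++ ys) f ≡ ∑ xs f + ∑ ys f
∑-++ []       ys f = refl
∑-++ (x ∷ xs) ys f = trans (cong (f x +_) (∑-++ xs ys f)) (sym (+-assoc (f x) _ _))

∑-map : ∀ (xs : List A) (g : A → B) (f : B → ℕ) → ∑ (map g xs) f ≡ ∑[ x ∈ xs ] f (g x)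
∑-map []       g f = refl
∑-map (x ∷ xs) g f = cong (f (g x) +_) (∑-map xs g f)

∑-concatMap : ∀ (xs : List A) (g : A → List B) (f : B → ℕ) →
  ∑ (concatMap g xs) f ≡ ∑[ x ∈ xs ] ∑ (g x) f
∑-concatMap []       g f = refl
∑-concatMap (x ∷ xs) g f = trans (∑-++ (g x) _ f) (cong (∑ (g x) f +_) (∑-concatMap xs g f))

∑-comm : ∀ (xs : List A) (ys : List B) (f : A → B → ℕ) →
  ∑[ x ∈ xs ] ∑[ y ∈ ys ] f x y ≡ ∑[ y ∈ ys ] ∑[ x ∈ xs ] f x y
∑-comm []       ys f = sym (trans (∑-const ys 0) (*-zeroʳ (length ys)))
∑-comm (x ∷ xs) ys f = trans (cong (∑ ys (f x) +_) (∑-comm xs ys f))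
  (sym (∑-distrib-+ ys (f x) (λ y → ∑[ x′ ∈ xs ] f x′ y)))

∑-cartesianProduct : ∀ (xs : List A) (ys : List B) (f : A → B → ℕ) →
  ∑[ p ∈ cartesianProduct xs ys ] f (proj₁ p) (proj₂ p) ≡ ∑[ x ∈ xs ] ∑[ y ∈ ys ] f x y
∑-cartesianProduct []       ys f = refl
∑-cartesianProduct (x ∷ xs) ys f = trans (∑-++ (map (x ,_) ys) _ _)
  (cong₂ _+_ (∑-map ys (x ,_) _) (∑-cartesianProduct xs ys f))

length≡∑1 : ∀ (xs : List A) → length xs ≡ ∑[ x ∈ xs ] 1
length≡∑1 []       = refl
length≡∑1 (x ∷ xs) = cong suc (length≡∑1 xs)

module _ {p} {P : A → Set p} (P? : ∀ x → Dec (P x)) where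

  ∑-filter : ∀ (xs : List A) (f : A → ℕ) → ∑ (filter P? xs) f ≡ ∑[ x ∈ xs ] 𝟙 (does (P? x)) * f x
  ∑-filter []       f = refl
  ∑-filter (x ∷ xs) f with does (P? x)
  ... | true  = cong₂ _+_ (sym (+-identityʳ (f x))) (∑-filter xs f)
  ... | false = ∑-filter xs f

  length-filter≡∑𝟙 : ∀ (xs : List A) → length (filter P? xs) ≡ ∑[ x ∈ xs ] 𝟙 (does (P? x))
  length-filter≡∑𝟙 []       = refl
  length-filter≡∑𝟙 (x ∷ xs) with does (P? x)
  ... | true  = cong suc (length-filter≡∑𝟙 xs)
  ... | false = length-filter≡∑𝟙 xs

module _ (_≟_ : DecidableEquality A) {q : A} where

  *-𝟙-≢ : ∀ (f : A → ℕ) {x} → q ≢ x → f x * 𝟙 (does (q ≟ x)) ≡ 0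
  *-𝟙-≢ f {x} q≢x = trans (cong (λ b → f x * 𝟙 b) (dec-false (q ≟ x) q≢x)) (*-zeroʳ (f x))

  ∑-select-∉ : ∀ (f : A → ℕ) {xs} → All (q ≢_) xs → ∑[ x ∈ xs ] f x * 𝟙 (does (q ≟ x)) ≡ 0
  ∑-select-∉ f []             = refl
  ∑-select-∉ f (q≢x ∷ q∉xs) = cong₂ _+_ (*-𝟙-≢ f q≢x) (∑-select-∉ f q∉xs)

  ∑-select : ∀ (f : A → ℕ) {xs} → Unique xs → q ∈ xs → ∑[ x ∈ xs ] f x * 𝟙 (does (q ≟ x)) ≡ f q
  ∑-select f (q∉xs ∷ _) (here refl) = begin
    f q * 𝟙 (does (q ≟ q)) + _
      ≡⟨ cong₂ _+_ (cong (λ b → f q * 𝟙 b) (dec-true (q ≟ q) refl)) (∑-select-∉ f q∉xs) ⟩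
    f q * 1 + 0
      ≡⟨ trans (+-identityʳ _) (*-identityʳ (f q)) ⟩
    f q
      ∎
    where open ≡-Reasoning
  ∑-select f (x∉xs ∷ u) (there q∈xs) =
    cong₂ _+_ (*-𝟙-≢ f (λ q≡x → All.lookup x∉xs q∈xs (sym q≡x))) (∑-select f u q∈xs)

  ∑-𝟙-≟ : ∀ {xs} → Unique xs → q ∈ xs → ∑[ x ∈ xs ] 𝟙 (does (x ≟ q)) ≡ 1
  ∑-𝟙-≟ {xs} u q∈xs = trans (∑-cong xs (λ {x} _ → flip-≟ x)) (∑-select (λ _ → 1) u q∈xs)
    where
    flip-≟ : ∀ x → 𝟙 (does (x ≟ q)) ≡ 1 * 𝟙 (does (q ≟ x))
    flip-≟ x = trans (𝟙-does-⇔ (x ≟ q) (q ≟ x) (mk⇔ sym sym)) (sym (*-identityˡ _))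

∑-allFin-suc : ∀ {k} (f : Fin (suc k) → ℕ) →
  ∑[ i ∈ allFin (suc k) ] f i ≡ f zero + ∑[ i ∈ allFin k ] f (suc i)
∑-allFin-suc f = cong (λ xs → f zero + sum xs)
  (trans (map-tabulate suc f) (sym (map-tabulate (λ i → i) (f ∘ suc))))

∑-allFin-const : ∀ k c → ∑[ i ∈ allFin k ] c ≡ k * c
∑-allFin-const k c = trans (∑-const (allFin k) c) (cong (_* c) (length-tabulate {n = k} (λ i → i)))

-- Counting injective tuples

module _ {n : ℕ} where

  open import Data.Vec.Membership.DecPropositional (_≟_ {n}) using (_∈?_)

  injectiveᵇ : ∀ {k} → Vec (Fin n) k → Bool
  injectiveᵇ []ᵥ       = true
  injectiveᵇ (y ∷ᵥ w) = not (does (y ∈? w)) ∧ injectiveᵇ w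

  head-∉ : ∀ {k} y (w : Vec (Fin n) k) → T (injectiveᵇ (y ∷ᵥ w)) → y ∉ᵥ w
  head-∉ y w inj = Equivalence.to (T-not-does⇔¬ (y ∈? w)) (proj₁ (Equivalence.to T-∧ inj))

  tail-injective : ∀ {k} y (w : Vec (Fin n) k) → T (injectiveᵇ (y ∷ᵥ w)) → T (injectiveᵇ w)
  tail-injective y w inj = proj₂ (Equivalence.to T-∧ inj)

  T-injectiveᵇ : ∀ {k} (w : Vec (Fin n) k) → T (injectiveᵇ w) ⇔ Injective _≡_ _≡_ (lookup w)
  T-injectiveᵇ []ᵥ       = mk⇔ (λ _ {i} → contradiction i λ ()) (λ _ → _)
  T-injectiveᵇ (y ∷ᵥ w) = mk⇔ to from
    where
    to : T (injectiveᵇ (y ∷ᵥ w)) → Injective _≡_ _≡_ (lookup (y ∷ᵥ w))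
    to inj {zero}  {zero}  _     = refl
    to inj {zero}  {suc j} y≡wj  = contradiction (subst (_∈ᵥ w) (sym y≡wj) (∈-lookup j w)) (head-∉ y w inj)
    to inj {suc i} {zero}  wi≡y  = contradiction (subst (_∈ᵥ w) wi≡y (∈-lookup i w)) (head-∉ y w inj)
    to inj {suc i} {suc j} wi≡wj =
      cong suc (Equivalence.to (T-injectiveᵇ w) (tail-injective y w inj) wi≡wj)

    from : Injective _≡_ _≡_ (lookup (y ∷ᵥ w)) → T (injectiveᵇ (y ∷ᵥ w))
    from inj = Equivalence.from T-∧
      ( Equivalence.from (T-not-does⇔¬ (y ∈? w))
          (λ y∈w → contradiction (inj {zero} {suc (index y∈w)} (lookup-index y∈w)) λ ())
      , Equivalence.from (T-injectiveᵇ w) (Fin.suc-injective ∘ inj) )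

  𝟙-∈?-∷ : ∀ {k} q y (w : Vec (Fin n) k) → y ∉ᵥ w →
    𝟙 (does (q ∈? (y ∷ᵥ w))) ≡ 𝟙 (does (q ≟ y)) + 𝟙 (does (q ∈? w))
  𝟙-∈?-∷ q y w y∉w = 𝟙-⊎-dec (q ≟ y) (q ∈? w) (λ { refl → y∉w })

  𝟙-∈?≡∑-lookup : ∀ {k} q (w : Vec (Fin n) k) → T (injectiveᵇ w) →
    𝟙 (does (q ∈? w)) ≡ ∑[ p ∈ allFin k ] 𝟙 (does (q ≟ lookup w p))
  𝟙-∈?≡∑-lookup q []ᵥ       _   = refl
  𝟙-∈?≡∑-lookup q (y ∷ᵥ w) inj = begin
    𝟙 (does (q ∈? (y ∷ᵥ w)))
      ≡⟨ 𝟙-∈?-∷ q y w (head-∉ y w inj) ⟩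
    𝟙 (does (q ≟ y)) + 𝟙 (does (q ∈? w))
      ≡⟨ cong (𝟙 (does (q ≟ y)) +_) (𝟙-∈?≡∑-lookup q w (tail-injective y w inj)) ⟩
    𝟙 (does (q ≟ y)) + ∑[ p ∈ allFin _ ] 𝟙 (does (q ≟ lookup w p))
      ≡⟨ ∑-allFin-suc (λ p → 𝟙 (does (q ≟ lookup (y ∷ᵥ w) p))) ⟨
    ∑[ p ∈ allFin _ ] 𝟙 (does (q ≟ lookup (y ∷ᵥ w) p))
      ∎
    where open ≡-Reasoning

  count-∈ : ∀ {k} (w : Vec (Fin n) k) → T (injectiveᵇ w) → ∑[ x ∈ allFin n ] 𝟙 (does (x ∈? w)) ≡ k
  count-∈ []ᵥ       _   = trans (∑-allFin-const n 0) (*-zeroʳ n)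
  count-∈ (y ∷ᵥ w) inj = begin
    ∑[ x ∈ allFin n ] 𝟙 (does (x ∈? (y ∷ᵥ w)))
      ≡⟨ ∑-cong (allFin n) (λ {x} _ → 𝟙-∈?-∷ x y w (head-∉ y w inj)) ⟩
    ∑[ x ∈ allFin n ] (𝟙 (does (x ≟ y)) + 𝟙 (does (x ∈? w)))
      ≡⟨ ∑-distrib-+ (allFin n) _ _ ⟩
    ∑[ x ∈ allFin n ] 𝟙 (does (x ≟ y)) + ∑[ x ∈ allFin n ] 𝟙 (does (x ∈? w))
      ≡⟨ cong₂ _+_ (∑-𝟙-≟ _≟_ (allFin⁺ n) (∈-allFin y)) (count-∈ w (tail-injective y w inj)) ⟩
    suc _
      ∎
    where open ≡-Reasoning

  count-∉ : ∀ {k} (w : Vec (Fin n) k) → T (injectiveᵇ w) →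
    ∑[ x ∈ allFin n ] 𝟙 (not (does (x ∈? w))) + k ≡ n
  count-∉ {k} w inj = begin
    ∑[ x ∈ allFin n ] 𝟙 (not (does (x ∈? w))) + k
      ≡⟨ cong (∑[ x ∈ allFin n ] 𝟙 (not (does (x ∈? w))) +_) (count-∈ w inj) ⟨
    ∑[ x ∈ allFin n ] 𝟙 (not (does (x ∈? w))) + ∑[ x ∈ allFin n ] 𝟙 (does (x ∈? w))
      ≡⟨ ∑-distrib-+ (allFin n) _ _ ⟨
    ∑[ x ∈ allFin n ] (𝟙 (not (does (x ∈? w))) + 𝟙 (does (x ∈? w)))
      ≡⟨ ∑-cong (allFin n) (λ {x} _ → 𝟙-not (does (x ∈? w))) ⟩
    ∑[ x ∈ allFin n ] 1
      ≡⟨ trans (∑-allFin-const n 1) (*-identityʳ n) ⟩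
    n
      ∎
    where open ≡-Reasoning

  ∑-allVecs-suc : ∀ k (f : Vec (Fin n) (suc k) → ℕ) →
    ∑[ w ∈ allVecs n (suc k) ] f w ≡ ∑[ x ∈ allFin n ] ∑[ w ∈ allVecs n k ] f (x ∷ᵥ w)
  ∑-allVecs-suc k f =
    trans (∑-concatMap (allFin n) _ f) (∑-cong (allFin n) (λ {x} _ → ∑-map (allVecs n k) (x ∷ᵥ_) f))

  injectiveSum : ∀ k → (Vec (Fin n) k → ℕ) → ℕ
  injectiveSum k h = ∑[ w ∈ allVecs n k ] 𝟙 (injectiveᵇ w) * h w

  -- An injective k-tuple extends to an injective (k+1)-tuple in exactly n − k ways.
  extensions-count : ∀ {k} (w : Vec (Fin n) k) z →
    ∑[ x ∈ allFin n ] 𝟙 (injectiveᵇ (x ∷ᵥ w)) * z + k * (𝟙 (injectiveᵇ w) * z) ≡ n * (𝟙 (injectiveᵇ w) * z)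
  extensions-count {k} w z = begin
    ∑[ x ∈ allFin n ] 𝟙 (injectiveᵇ (x ∷ᵥ w)) * z + k * (i * z)
      ≡⟨ cong (_+ k * (i * z)) (∑-cong (allFin n) (λ {x} _ → new-entry x)) ⟩
    ∑[ x ∈ allFin n ] free x * (i * z) + k * (i * z)
      ≡⟨ cong (_+ k * (i * z)) (*-distribʳ-∑ (i * z) (allFin n) free) ⟨
    X * (i * z) + k * (i * z)
      ≡⟨ *-distribʳ-+ (i * z) X k ⟨
    (X + k) * (i * z)
      ≡⟨ *-leftComm (X + k) i z ⟩
    i * ((X + k) * z)
      ≡⟨ 𝟙-guard (injectiveᵇ w) (cong (_* z) ∘ count-∉ w) ⟩
    i * (n * z)
      ≡⟨ *-leftComm i n z ⟩
    n * (i * z)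
      ∎
    where
    open ≡-Reasoning
    i = 𝟙 (injectiveᵇ w)
    free = λ x → 𝟙 (not (does (x ∈? w)))
    X = ∑[ x ∈ allFin n ] free x
    new-entry : ∀ x → 𝟙 (injectiveᵇ (x ∷ᵥ w)) * z ≡ free x * (i * z)
    new-entry x = trans (cong (_* z) (𝟙-∧ (not (does (x ∈? w))) (injectiveᵇ w))) (*-assoc (free x) i z)

  injectiveSum-suc : ∀ k (h : Vec (Fin n) k → ℕ) (h′ : Vec (Fin n) (suc k) → ℕ) →
    (∀ x w → h′ (x ∷ᵥ w) ≡ h w) → injectiveSum (suc k) h′ + k * injectiveSum k h ≡ n * injectiveSum k h
  injectiveSum-suc k h h′ h′≡h = begin
    injectiveSum (suc k) h′ + k * injectiveSum k h
      ≡⟨ cong₂ _+_ extend-last (*-distribˡ-∑ k (allVecs n k) _) ⟩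
    ∑[ w ∈ allVecs n k ] E w + ∑[ w ∈ allVecs n k ] k * (𝟙 (injectiveᵇ w) * h w)
      ≡⟨ ∑-distrib-+ (allVecs n k) _ _ ⟨
    ∑[ w ∈ allVecs n k ] (E w + k * (𝟙 (injectiveᵇ w) * h w))
      ≡⟨ ∑-cong (allVecs n k) (λ {w} _ → extensions-count w (h w)) ⟩
    ∑[ w ∈ allVecs n k ] n * (𝟙 (injectiveᵇ w) * h w)
      ≡⟨ *-distribˡ-∑ n (allVecs n k) _ ⟨
    n * injectiveSum k h
      ∎
    where
    open ≡-Reasoning
    E = λ w → ∑[ x ∈ allFin n ] 𝟙 (injectiveᵇ (x ∷ᵥ w)) * h w
    extend-last : injectiveSum (suc k) h′ ≡ ∑[ w ∈ allVecs n k ] E w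
    extend-last = trans (∑-allVecs-suc k _) (trans
      (∑-cong (allFin n) (λ {x} _ → ∑-cong (allVecs n k) (λ {w} _ → cong (𝟙 (injectiveᵇ (x ∷ᵥ w)) *_) (h′≡h x w))))
      (∑-comm (allFin n) (allVecs n k) _))

  injectiveCount : ℕ → ℕ
  injectiveCount k = injectiveSum k (λ _ → 1)

  hitCount : ∀ k → Fin n → Fin k → ℕ
  hitCount k q p = injectiveSum k (λ w → 𝟙 (does (q ≟ lookup w p)))

  injectiveCount-suc : ∀ k → injectiveCount (suc k) + k * injectiveCount k ≡ n * injectiveCount k
  injectiveCount-suc k = injectiveSum-suc k _ _ (λ _ _ → refl)

  injectiveCount-suc-unique : ∀ k {x} →
    x + k * injectiveCount k ≡ n * injectiveCount k → x ≡ injectiveCount (suc k)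
  injectiveCount-suc-unique k {x} eq =
    +-cancelʳ-≡ (k * injectiveCount k) x _ (trans eq (sym (injectiveCount-suc k)))

  injectiveCount≡P′ : ∀ k → injectiveCount k ≡ n P′ k
  injectiveCount≡P′ zero    = refl
  injectiveCount≡P′ (suc k) = begin
    injectiveCount (suc k)
      ≡⟨ m+n∸n≡m _ (k * injectiveCount k) ⟨
    injectiveCount (suc k) + k * injectiveCount k ∸ k * injectiveCount k
      ≡⟨ cong (_∸ k * injectiveCount k) (injectiveCount-suc k) ⟩
    n * injectiveCount k ∸ k * injectiveCount k
      ≡⟨ *-distribʳ-∸ (injectiveCount k) n k ⟨
    (n ∸ k) * injectiveCount k
      ≡⟨ cong ((n ∸ k) *_) (injectiveCount≡P′ k) ⟩
    n P′ suc k
      ∎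
    where open ≡-Reasoning

  hitCount-suc-suc : ∀ k q p → hitCount (suc k) q (suc p) + k * hitCount k q p ≡ n * hitCount k q p
  hitCount-suc-suc k q p = injectiveSum-suc k _ _ (λ _ _ → refl)

  hitCount-suc-zero : ∀ k q →
    hitCount (suc k) q zero + ∑[ p ∈ allFin k ] hitCount k q p ≡ injectiveCount k
  hitCount-suc-zero k q = begin
    hitCount (suc k) q zero + ∑[ p ∈ allFin k ] hitCount k q p
      ≡⟨ cong₂ _+_ head-hits tail-hits ⟩
    ∑[ w ∈ allVecs n k ] 𝟙 (not (b w) ∧ injectiveᵇ w) + ∑[ w ∈ allVecs n k ] 𝟙 (injectiveᵇ w) * 𝟙 (b w)
      ≡⟨ ∑-distrib-+ (allVecs n k) _ _ ⟨
    ∑[ w ∈ allVecs n k ] (𝟙 (not (b w) ∧ injectiveᵇ w) + 𝟙 (injectiveᵇ w) * 𝟙 (b w))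
      ≡⟨ ∑-cong (allVecs n k) (λ {w} _ → q∉w-or-q∈w w) ⟩
    injectiveCount k
      ∎
    where
    open ≡-Reasoning
    b = λ w → does (q ∈? w)
    head-hits : hitCount (suc k) q zero ≡ ∑[ w ∈ allVecs n k ] 𝟙 (not (b w) ∧ injectiveᵇ w)
    head-hits = trans (∑-allVecs-suc k _) (trans (∑-comm (allFin n) (allVecs n k) _)
      (∑-cong (allVecs n k) (λ {w} _ →
        ∑-select _≟_ (λ x → 𝟙 (injectiveᵇ (x ∷ᵥ w))) (allFin⁺ n) (∈-allFin q))))
    tail-hits : ∑[ p ∈ allFin k ] hitCount k q p ≡ ∑[ w ∈ allVecs n k ] 𝟙 (injectiveᵇ w) * 𝟙 (b w)
    tail-hits = trans (∑-comm (allFin k) (allVecs n k) _) (∑-cong (allVecs n k) λ {w} _ →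
      trans (sym (*-distribˡ-∑ (𝟙 (injectiveᵇ w)) (allFin k) _))
            (𝟙-guard (injectiveᵇ w) (sym ∘ 𝟙-∈?≡∑-lookup q w)))
    q∉w-or-q∈w : ∀ w → 𝟙 (not (b w) ∧ injectiveᵇ w) + 𝟙 (injectiveᵇ w) * 𝟙 (b w) ≡ 𝟙 (injectiveᵇ w) * 1
    q∉w-or-q∈w w = begin
      𝟙 (not (b w) ∧ injectiveᵇ w) + i * 𝟙 (b w)
        ≡⟨ cong (_+ i * 𝟙 (b w)) (trans (𝟙-∧ (not (b w)) (injectiveᵇ w)) (*-comm (𝟙 (not (b w))) i)) ⟩
      i * 𝟙 (not (b w)) + i * 𝟙 (b w)
        ≡⟨ *-distribˡ-+ i (𝟙 (not (b w))) (𝟙 (b w)) ⟨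
      i * (𝟙 (not (b w)) + 𝟙 (b w))
        ≡⟨ cong (i *_) (𝟙-not (b w)) ⟩
      i * 1
        ∎
      where i = 𝟙 (injectiveᵇ w)

  n*hitCount≡injectiveCount : ∀ k q (p : Fin k) → n * hitCount k q p ≡ injectiveCount k
  n*hitCount≡injectiveCount (suc k) q zero = injectiveCount-suc-unique k (begin
    n * hitCount (suc k) q zero + k * injectiveCount k
      ≡⟨ cong (n * hitCount (suc k) q zero +_) tail-hits ⟨
    n * hitCount (suc k) q zero + n * (∑[ p ∈ allFin k ] hitCount k q p)
      ≡⟨ *-distribˡ-+ n _ _ ⟨
    n * (hitCount (suc k) q zero + ∑[ p ∈ allFin k ] hitCount k q p)
      ≡⟨ cong (n *_) (hitCount-suc-zero k q) ⟩
    n * injectiveCount k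
      ∎)
    where
    open ≡-Reasoning
    tail-hits : n * (∑[ p ∈ allFin k ] hitCount k q p) ≡ k * injectiveCount k
    tail-hits = trans (*-distribˡ-∑ n (allFin k) _)
      (trans (∑-cong (allFin k) (λ {p} _ → n*hitCount≡injectiveCount k q p)) (∑-allFin-const k _))
  n*hitCount≡injectiveCount (suc k) q (suc p) = injectiveCount-suc-unique k (begin
    n * hitCount (suc k) q (suc p) + k * injectiveCount k
      ≡⟨ cong (λ c → n * hitCount (suc k) q (suc p) + k * c) (n*hitCount≡injectiveCount k q p) ⟨
    n * hitCount (suc k) q (suc p) + k * (n * hitCount k q p)
      ≡⟨ cong (n * hitCount (suc k) q (suc p) +_) (*-leftComm k n _) ⟩
    n * hitCount (suc k) q (suc p) + n * (k * hitCount k q p)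
      ≡⟨ *-distribˡ-+ n _ _ ⟨
    n * (hitCount (suc k) q (suc p) + k * hitCount k q p)
      ≡⟨ cong (n *_) (hitCount-suc-suc k q p) ⟩
    n * (n * hitCount k q p)
      ≡⟨ cong (n *_) (n*hitCount≡injectiveCount k q p) ⟩
    n * injectiveCount k
      ∎)
    where open ≡-Reasoning

P′-n≡n! : ∀ n → n P′ n ≡ n !
P′-n≡n! n =
  trans (cong (λ b → if b then n P′ n else 0) (sym (Equivalence.to T-≡ (≤⇒≤ᵇ (≤-refl {n}))))) (nPn≡n! n)

-- The enumeration Sn

-- isPermᵇ tests each pair with a disjunction bound in its own where block, which cannot be
-- named here; pairTest v refl recovers that test by unification.
pairTest : ∀ {n} (v : Vec (Fin n) n) {test : Fin n → Fin n → Bool} →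
  isPermᵇ v ≡ all (λ i → all (test i) (allFin n)) (allFin n) → Fin n → Fin n → Bool
pairTest v {test} _ = test

T-pairTest : ∀ {n} (v : Vec (Fin n) n) i j → T (pairTest v refl i j) ⇔ (lookup v i ≡ lookup v j → i ≡ j)
T-pairTest v i j with i ≟ j
... | yes i≡j = mk⇔ (λ _ _ → i≡j) (λ _ → _)
... | no  i≢j = mk⇔
  (λ t vi≡vj → contradiction vi≡vj (Equivalence.to (T-not-does⇔¬ (lookup v i ≟ lookup v j)) t))
  (λ inj → Equivalence.from (T-not-does⇔¬ (lookup v i ≟ lookup v j)) (i≢j ∘ inj))

T-all-allFin² : ∀ {n} (test : Fin n → Fin n → Bool) →
  T (all (λ i → all (test i) (allFin n)) (allFin n)) ⇔ (∀ i j → T (test i j))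
T-all-allFin² {n} test = mk⇔
  (λ t i j → All.lookup (all⁺ (test i) (allFin n) (All.lookup (all⁺ _ (allFin n) t) (∈-allFin i))) (∈-allFin j))
  (λ t → all⁻ _ {allFin n} (All.tabulate λ {i} _ → all⁻ (test i) {allFin n} (All.tabulate λ {j} _ → t i j)))

T-isPermᵇ : ∀ {n} (v : Vec (Fin n) n) → T (isPermᵇ v) ⇔ Injective _≡_ _≡_ (lookup v)
T-isPermᵇ v = mk⇔
  (λ t {i} {j} → Equivalence.to (T-pairTest v i j) (Equivalence.to (T-all-allFin² _) t i j))
  (λ inj → Equivalence.from (T-all-allFin² _) (λ i j → Equivalence.from (T-pairTest v i j) inj))

isPermᵇ≡injectiveᵇ : ∀ {n} (v : Vec (Fin n) n) → isPermᵇ v ≡ injectiveᵇ v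
isPermᵇ≡injectiveᵇ v =
  ⇔→≡ (⇔.trans (⇔.sym T-≡) (⇔.trans (T-isPermᵇ v) (⇔.trans (⇔.sym (T-injectiveᵇ v)) T-≡)))

module _ {n : ℕ} where

  ∑-Sn : (f : Vec (Fin n) n → ℕ) → ∑[ v ∈ Sn n ] f v ≡ injectiveSum n f
  ∑-Sn f = trans (∑-filter (λ v → isPermᵇ v 𝔹.≟ true) (allVecs n n) f) (∑-cong (allVecs n n) λ {v} _ →
    cong (_* f v) (trans (𝟙-does-≟true (isPermᵇ v)) (cong 𝟙 (isPermᵇ≡injectiveᵇ v))))
    where
    𝟙-does-≟true : ∀ b → 𝟙 (does (b 𝔹.≟ true)) ≡ 𝟙 b
    𝟙-does-≟true true  = refl
    𝟙-does-≟true false = refl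

  length-Sn≡injectiveCount : length (Sn n) ≡ injectiveCount n
  length-Sn≡injectiveCount = trans (length≡∑1 (Sn n)) (∑-Sn (λ _ → 1))

  length-Sn : length (Sn n) ≡ n !
  length-Sn = trans length-Sn≡injectiveCount (trans (injectiveCount≡P′ n) (P′-n≡n! n))

  fixedᵥ≤n : ∀ v → fixedᵥ v ≤ n
  fixedᵥ≤n v = subst (fixedᵥ v ≤_) (length-tabulate {n = n} (λ i → i))
    (length-filter (λ x → lookup v x ≟ x) (allFin n))

  ∑-Sn-fixedᵥ : .{{NonZero n}} → ∑[ v ∈ Sn n ] fixedᵥ v ≡ length (Sn n)
  ∑-Sn-fixedᵥ = *-cancelˡ-≡ _ _ n (begin
    n * (∑[ v ∈ Sn n ] fixedᵥ v)
      ≡⟨ cong (n *_) (trans (∑-Sn fixedᵥ) fixed-points-as-hits) ⟩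
    n * (∑[ x ∈ allFin n ] hitCount n x x)
      ≡⟨ *-distribˡ-∑ n (allFin n) _ ⟩
    ∑[ x ∈ allFin n ] n * hitCount n x x
      ≡⟨ ∑-cong (allFin n) (λ {x} _ → n*hitCount≡injectiveCount n x x) ⟩
    ∑[ x ∈ allFin n ] injectiveCount n
      ≡⟨ ∑-allFin-const n _ ⟩
    n * injectiveCount n
      ≡⟨ cong (n *_) length-Sn≡injectiveCount ⟨
    n * length (Sn n)
      ∎)
    where
    open ≡-Reasoning
    fixedᵥ≡∑ : ∀ v → fixedᵥ v ≡ ∑[ x ∈ allFin n ] 𝟙 (does (x ≟ lookup v x))
    fixedᵥ≡∑ v = trans (length-filter≡∑𝟙 (λ x → lookup v x ≟ x) (allFin n))
      (∑-cong (allFin n) (λ {x} _ → 𝟙-does-⇔ (lookup v x ≟ x) (x ≟ lookup v x) (mk⇔ sym sym)))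
    fixed-points-as-hits : injectiveSum n fixedᵥ ≡ ∑[ x ∈ allFin n ] hitCount n x x
    fixed-points-as-hits = trans
      (∑-cong (allVecs n n) (λ {v} _ →
        trans (cong (𝟙 (injectiveᵇ v) *_) (fixedᵥ≡∑ v)) (*-distribˡ-∑ (𝟙 (injectiveᵇ v)) (allFin n) _)))
      (∑-comm (allVecs n n) (allFin n) _)

-- Distances and the bound

Σ0to-levels : ∀ n (xs : List A) {p} {P : A → ℕ → Set p} (P? : ∀ x j → Dec (P x j)) (g : A → ℕ) →
  (∀ x → g x ≤ n) → (∀ x j → j ≤ n → P x j ⇔ g x ≡ j) →
  Σ0to n (λ j → length (filter (λ x → P? x j) xs) * j ^ 1) ≡ ∑[ x ∈ xs ] g x
Σ0to-levels n xs P? g g≤n P⇔g≡ = begin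
  ∑[ j ∈ upTo (suc n) ] length (filter (λ x → P? x j) xs) * j ^ 1
    ≡⟨ ∑-cong (upTo (suc n)) (λ {j} _ → cong₂ _*_ (length-filter≡∑𝟙 (λ x → P? x j) xs) (*-identityʳ j)) ⟩
  ∑[ j ∈ upTo (suc n) ] (∑[ x ∈ xs ] 𝟙 (does (P? x j))) * j
    ≡⟨ ∑-cong (upTo (suc n)) (λ {j} _ → *-distribʳ-∑ j xs _) ⟩
  ∑[ j ∈ upTo (suc n) ] ∑[ x ∈ xs ] 𝟙 (does (P? x j)) * j
    ≡⟨ ∑-comm (upTo (suc n)) xs _ ⟩
  ∑[ x ∈ xs ] ∑[ j ∈ upTo (suc n) ] 𝟙 (does (P? x j)) * j
    ≡⟨ ∑-cong xs (λ {x} _ → ∑-cong (upTo (suc n)) (λ {j} j∈ → level x j (∈-upTo⁻ j∈))) ⟩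
  ∑[ x ∈ xs ] ∑[ j ∈ upTo (suc n) ] j * 𝟙 (does (g x ℕ.≟ j))
    ≡⟨ ∑-cong xs (λ {x} _ → ∑-select ℕ._≟_ (λ j → j) (upTo⁺ (suc n)) (∈-upTo⁺ (s≤s (g≤n x)))) ⟩
  ∑[ x ∈ xs ] g x
    ∎
  where
  open ≡-Reasoning
  level : ∀ x j → j < suc n → 𝟙 (does (P? x j)) * j ≡ j * 𝟙 (does (g x ℕ.≟ j))
  level x j (s≤s j≤n) =
    trans (cong (_* j) (𝟙-does-⇔ (P? x j) (g x ℕ.≟ j) (P⇔g≡ x j j≤n))) (*-comm _ j)

module _ {n : ℕ} where

  dS-refl : (σ : Permutation′ n) → dS σ σ ≡ 0
  dS-refl σ = begin
    n ∸ length (filter (λ x → (σ · σ ⁻¹) ⟨$⟩ʳ x ≟ x) (allFin n))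
      ≡⟨ cong (λ xs → n ∸ length xs) (filter-all _ (All.universal (λ _ → inverseʳ σ) (allFin n))) ⟩
    n ∸ length (allFin n)
      ≡⟨ cong (n ∸_) (length-tabulate {n = n} (λ i → i)) ⟩
    n ∸ n
      ≡⟨ n∸n≡0 n ⟩
    0
      ∎
    where open ≡-Reasoning

  dS≤n : (σ θ : Permutation′ n) → dS σ θ ≤ n
  dS≤n σ θ = m∸n≤m n (F (σ · θ ⁻¹))

  Σ0to-pairCount : (D : List (Permutation′ n)) →
    Σ0to n (λ j → pairCount D j * j ^ 1) ≡ ∑[ σ ∈ D ] ∑[ θ ∈ D ] dS σ θ
  Σ0to-pairCount D = trans
    (Σ0to-levels n (cartesianProduct D D) (λ p j → dS (proj₁ p) (proj₂ p) ℕ.≟ j) (λ p → dS (proj₁ p) (proj₂ p))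
      (λ p → dS≤n (proj₁ p) (proj₂ p)) (λ _ _ _ → ⇔.refl))
    (∑-cartesianProduct D D dS)

  Σ0to-vcount : Σ0to n (λ j → vcount n j * j ^ 1) ≡ ∑[ v ∈ Sn n ] (n ∸ fixedᵥ v)
  Σ0to-vcount = Σ0to-levels n (Sn n) (λ v j → fixedᵥ v ℕ.≟ n ∸ j) (λ v → n ∸ fixedᵥ v)
    (λ v → m∸n≤m n (fixedᵥ v))
    (λ v j j≤n → mk⇔ (λ e → trans (cong (n ∸_) e) (m∸[m∸n]≡n j≤n))
                     (λ e → trans (sym (m∸[m∸n]≡n (fixedᵥ≤n v))) (cong (n ∸_) e)))

  Σ0to-vcount+n! : .{{NonZero n}} → Σ0to n (λ j → vcount n j * j ^ 1) + n ! ≡ n ! * n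
  Σ0to-vcount+n! = begin
    Σ0to n (λ j → vcount n j * j ^ 1) + n !
      ≡⟨ cong₂ _+_ Σ0to-vcount (trans (sym (length-Sn {n})) (sym (∑-Sn-fixedᵥ {n}))) ⟩
    ∑[ v ∈ Sn n ] (n ∸ fixedᵥ v) + ∑[ v ∈ Sn n ] fixedᵥ v
      ≡⟨ ∑-distrib-+ (Sn n) _ _ ⟨
    ∑[ v ∈ Sn n ] (n ∸ fixedᵥ v + fixedᵥ v)
      ≡⟨ ∑-cong (Sn n) (λ {v} _ → m∸n+n≡m (fixedᵥ≤n v)) ⟩
    ∑[ v ∈ Sn n ] n
      ≡⟨ ∑-const (Sn n) n ⟩
    length (Sn n) * n
      ≡⟨ cong (_* n) (length-Sn {n}) ⟩
    n ! * n
      ∎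
    where open ≡-Reasoning

  ∑∑dS+Ln≤LLn : (D : List (Permutation′ n)) →
    ∑[ σ ∈ D ] ∑[ θ ∈ D ] dS σ θ + length D * n ≤ length D * (length D * n)
  ∑∑dS+Ln≤LLn D = begin
    ∑[ σ ∈ D ] ∑[ θ ∈ D ] dS σ θ + length D * n
      ≡⟨ cong (∑[ σ ∈ D ] ∑[ θ ∈ D ] dS σ θ +_) (∑-const D n) ⟨
    ∑[ σ ∈ D ] ∑[ θ ∈ D ] dS σ θ + ∑[ σ ∈ D ] n
      ≡⟨ ∑-distrib-+ D _ _ ⟨
    ∑[ σ ∈ D ] (∑[ θ ∈ D ] dS σ θ + n)
      ≤⟨ ∑-mono-≤ D (λ {σ} σ∈D → ∑-≤-with-zero D (dS≤n σ) σ∈D (dS-refl σ)) ⟩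
    ∑[ σ ∈ D ] length D * n
      ≡⟨ ∑-const D _ ⟩
    length D * (length D * n)
      ∎
    where open ≤-Reasoning

first-moment-bound : ∀ {N L n A P} .{{_ : NonZero N}} .{{_ : NonZero L}} →
  N * P ≡ L * L * A → A + N ≡ N * n → P + L * n ≤ L * (L * n) → n ≤ L
first-moment-bound {N} {L} {n} {A} {P} NP≡LLA A+N≡Nn P+Ln≤LLn =
  *-cancelˡ-≤ (N * L) {{m*n≢0 N L}} (+-cancelˡ-≤ (N * P) _ _ (begin
    N * P + N * L * n          ≡⟨ cong (N * P +_) (*-assoc N L n) ⟩
    N * P + N * (L * n)        ≡⟨ *-distribˡ-+ N P (L * n) ⟨
    N * (P + L * n)            ≤⟨ *-monoʳ-≤ N P+Ln≤LLn ⟩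
    N * (L * (L * n))          ≡⟨ regroup₁ N L n ⟩
    L * L * (N * n)            ≡⟨ cong (L * L *_) A+N≡Nn ⟨
    L * L * (A + N)            ≡⟨ *-distribˡ-+ (L * L) A N ⟩
    L * L * A + L * L * N      ≡⟨ cong₂ _+_ NP≡LLA (regroup₂ N L) ⟨
    N * P + N * L * L          ∎))
  where
  open ≤-Reasoning
  regroup₁ : ∀ N L n → N * (L * (L * n)) ≡ L * L * (N * n)
  regroup₁ = solve-∀
  regroup₂ : ∀ N L → N * L * L ≡ L * L * N
  regroup₂ = solve-∀

corollary1 : (n : ℕ) → 1 ≤ n → (Y : List (Permutation′ n)) →
    DistinctPerms Y → 1 ≤ length Y → IsDesign n 1 Y → n ≤ length Y
corollary1 n@(suc _) _ Y _ 1≤|Y| design =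
  first-moment-bound {{n !≢0}} {{>-nonZero 1≤|Y|}} pair-moment (Σ0to-vcount+n! {n}) (∑∑dS+Ln≤LLn Y)
  where
  pair-moment : n ! * (∑[ σ ∈ Y ] ∑[ θ ∈ Y ] dS σ θ) ≡ length Y * length Y * Σ0to n (λ j → vcount n j * j ^ 1)
  pair-moment = trans (cong (n ! *_) (sym (Σ0to-pairCount Y))) (design 1 ≤-refl ≤-refl)
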